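{- Let $\langle\mathbb{A},\Rightarrow\!\!>,\Rightarrow,[\top,\top]\rangle$ be an IBCI-algebra (or IBCK-algebra) obtained from $\langle A,\rightarrow,\top\rangle$. Then for all $X,Y\in\mathbb{A}$: (1) $X\Rightarrow\!\!> X=[\overline{X}\rightarrow\underline{X},\top]$; (2) $X\Rightarrow\!\!> Y=[\top,\top]$ iff $\overline{X}\preceq\underline{Y}$.
   Context: A BCI-algebra is a structure $\langle A,\rightarrow,\top\rangle$ such that for all $x,y,z\in A$: (C1) $(y\rightarrow z)\rightarrow((z\rightarrow x)\rightarrow(y\rightarrow x))=\top$; (C2) $x\rightarrow((x\rightarrow y)\rightarrow y)=\top$; (C3) $x\rightarrow x=\top$; (C4) $x\rightarrow y=\top$ and $y\rightarrow x=\top$ imply $x=y$; its induced order is $x\preceq y$ iff $x\rightarrow y=\top$; it is a BCK-algebra if moreover $x\rightarrow\top=\top$ for all $x$. Given a BCI- (resp. BCK-) algebra $\langle A,\rightarrow,\top\rangle$ such that $\langle A,\preceq\rangle$ is a meet-semilattice with $x\rightarrow(y\wedge z)=(x\rightarrow y)\wedge(x\rightarrow z)$ for all $x,y,z$, let $\mathbb{A}=\{[a,b]:a,b\in A,\ a\preceq b\}$, with $\underline{[a,b]}=a$, $\overline{[a,b]}=b$, and define $X\Rightarrow\!\!> Y=[\overline{X}\rightarrow\underline{Y},\ \underline{X}\rightarrow\overline{Y}]$ and $X\Rightarrow Y=[(\underline{X}\rightarrow\underline{Y})\wedge(\overline{X}\rightarrow\overline{Y}),\ \underline{X}\rightarrow\overline{Y}]$.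 The structure $\langle\mathbb{A},\Rightarrow\!\!>,\Rightarrow,[\top,\top]\rangle$ is called the interval BCI- (resp. BCK-) algebra, IBCI (IBCK). -}

module Defs where

open import Level using (Level; suc; _⊔_)
open import Data.Product using (_×_; _,_; proj₁; proj₂)
open import Relation.Binary.PropositionalEquality using (_≡_)

record BCIAlgebra (a : Level) : Set (suc a) where
  infixr 5 _⇾_
  field
    Carrier : Set a
    _⇾_     : Carrier → Carrier → Carrier
    ⊤       : Carrier
    C1 : ∀ x y z → (y ⇾ z) ⇾ ((z ⇾ x) ⇾ (y ⇾ x)) ≡ ⊤
    C2 : ∀ x y → x ⇾ ((x ⇾ y) ⇾ y) ≡ ⊤
    C3 : ∀ x → x ⇾ x ≡ ⊤
    C4 : ∀ x y → x ⇾ y ≡ ⊤ → y ⇾ x ≡ ⊤ → x ≡ y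

  _⪯_ : Carrier → Carrier → Set a
  x ⪯ y = x ⇾ y ≡ ⊤

record MeetBCIAlgebra (a : Level) : Set (suc a) where
  field
    bci : BCIAlgebra a
  open BCIAlgebra bci public
  field
    _∧_    : Carrier → Carrier → Carrier
    ∧-lbˡ  : ∀ x y → (x ∧ y) ⪯ x
    ∧-lbʳ  : ∀ x y → (x ∧ y) ⪯ y
    ∧-glb  : ∀ x y z → z ⪯ x → z ⪯ y → z ⪯ (x ∧ y)
    ⇾-∧    : ∀ x y z → x ⇾ (y ∧ z) ≡ (x ⇾ y) ∧ (x ⇾ z)

  record Interval : Set a where
    constructor [_,_]⟨_⟩
    field
      lo  : Carrier
      hi  : Carrier
      lo⪯hi : lo ⪯ hi
  open Interval public

  _≈I_ : Interval → Interval → Set a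
  X ≈I Y = (lo X ≡ lo Y) × (hi X ≡ hi Y)

  ⇒>-lo ⇒>-hi : Interval → Interval → Carrier
  ⇒>-lo X Y = hi X ⇾ lo Y
  ⇒>-hi X Y = lo X ⇾ hi Y

  ⊤I : Interval
  ⊤I = [ ⊤ , ⊤ ]⟨ C3 ⊤ ⟩

  -- "X ⇒> Y = [c,d]" stated endpoint-wise.
  _⇒>_≈[_,_] : Interval → Interval → Carrier → Carrier → Set a
  X ⇒> Y ≈[ c , d ] = (⇒>-lo X Y ≡ c) × (⇒>-hi X Y ≡ d)

-- For an interval X = [X̲, X̄] we have X ⇒> Y = [X̄ → Y̲, X̲ → Ȳ].
-- (1) X ⇒> X = [X̄ → X̲, X̲ → X̄], and X̲ → X̄ = ⊤ is exactly the defining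
--     condition X̲ ⪯ X̄ of an interval, so nothing beyond unfolding is needed.
-- (2) If X ⇒> Y = [⊤,⊤] then in particular X̄ → Y̲ = ⊤, i.e. X̄ ⪯ Y̲.
--     Conversely, from X̄ ⪯ Y̲ the chain X̲ ⪯ X̄ ⪯ Y̲ ⪯ Ȳ gives X̲ → Ȳ = ⊤,
--     so the only real ingredient is transitivity of ⪯.

module Submission where

open import Defs
open import Level using (Level)
open import Data.Product using (_×_; _,_; proj₁)
open import Function.Bundles using (_⇔_; mk⇔)
open import Relation.Binary.PropositionalEquality
  using (_≡_; refl; sym; cong; subst; module ≡-Reasoning)

module BCIProperties {a : Level} (B : BCIAlgebra a) where
  open BCIAlgebra B

  -- ⊤ is a left unit of →: the two inequalities ⊤ → x ⪯ x and x ⪯ ⊤ → x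
  -- are obtained from C1/C2 and then glued by antisymmetry C4.
  ⊤-⇾-identity : ∀ x → ⊤ ⇾ x ≡ x
  ⊤-⇾-identity x = C4 (⊤ ⇾ x) x ⊤⇾x⪯x x⪯⊤⇾x
    where
    x⇾⊤⪯[⊤⇾x]⇾⊤ : (x ⇾ ⊤) ⇾ ((⊤ ⇾ x) ⇾ ⊤) ≡ ⊤
    x⇾⊤⪯[⊤⇾x]⇾⊤ = subst (λ u → (x ⇾ ⊤) ⇾ ((⊤ ⇾ x) ⇾ u) ≡ ⊤) (C3 x) (C1 x x ⊤)
    [[⊤⇾x]⇾x]⪯⊤ : ((⊤ ⇾ x) ⇾ x) ⇾ ⊤ ≡ ⊤
    [[⊤⇾x]⇾x]⪯⊤ =
      subst (λ u → ((⊤ ⇾ x) ⇾ x) ⇾ u ≡ ⊤) x⇾⊤⪯[⊤⇾x]⇾⊤ (C1 ⊤ (⊤ ⇾ x) x)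
    ⊤⇾x⪯x : (⊤ ⇾ x) ⇾ x ≡ ⊤
    ⊤⇾x⪯x = C4 ((⊤ ⇾ x) ⇾ x) ⊤ [[⊤⇾x]⇾x]⪯⊤ (C2 ⊤ x)
    x⪯⊤⇾x : x ⇾ (⊤ ⇾ x) ≡ ⊤
    x⪯⊤⇾x = subst (λ u → x ⇾ (u ⇾ x) ≡ ⊤) (C3 x) (C2 x x)

  -- The induced order is transitive: instantiate C1 and discharge the two
  -- premises using that ⊤ is a left unit.
  ⪯-trans : ∀ {x y z} → x ⪯ y → y ⪯ z → x ⪯ z
  ⪯-trans {x} {y} {z} x⪯y y⪯z = begin
    x ⇾ z                            ≡⟨ sym (⊤-⇾-identity (x ⇾ z)) ⟩
    ⊤ ⇾ (x ⇾ z)                      ≡⟨ cong (λ u → u ⇾ (x ⇾ z)) (sym y⪯z) ⟩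
    (y ⇾ z) ⇾ (x ⇾ z)                ≡⟨ sym (⊤-⇾-identity _) ⟩
    ⊤ ⇾ ((y ⇾ z) ⇾ (x ⇾ z))          ≡⟨ cong (λ u → u ⇾ ((y ⇾ z) ⇾ (x ⇾ z))) (sym x⪯y) ⟩
    (x ⇾ y) ⇾ ((y ⇾ z) ⇾ (x ⇾ z))    ≡⟨ C1 z x y ⟩
    ⊤                                ∎
    where open ≡-Reasoning

module IntervalProperties {a : Level} (𝔸 : MeetBCIAlgebra a) where
  open MeetBCIAlgebra 𝔸
  open BCIProperties bci

  ⇒>-self : ∀ X → X ⇒> X ≈[ hi X ⇾ lo X , ⊤ ]
  ⇒>-self X = refl , lo⪯hi X

  lo⪯hi-of-hi⪯lo : ∀ X Y → hi X ⪯ lo Y → lo X ⪯ hi Y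
  lo⪯hi-of-hi⪯lo X Y hiX⪯loY = ⪯-trans (⪯-trans (lo⪯hi X) hiX⪯loY) (lo⪯hi Y)

  ⇒>-⊤-criterion : ∀ X Y → (X ⇒> Y ≈[ ⊤ , ⊤ ]) ⇔ (hi X ⪯ lo Y)
  ⇒>-⊤-criterion X Y =
    mk⇔ proj₁ (λ hiX⪯loY → hiX⪯loY , lo⪯hi-of-hi⪯lo X Y hiX⪯loY)

theorem3 : ∀ {a : Level} (𝔸 : MeetBCIAlgebra a) → let open MeetBCIAlgebra 𝔸 in
    ∀ (X Y : Interval) →
      (X ⇒> X ≈[ hi X ⇾ lo X , ⊤ ])
      × ((X ⇒> Y ≈[ ⊤ , ⊤ ]) ⇔ (hi X ⪯ lo Y))
theorem3 𝔸 X Y = ⇒>-self X , ⇒>-⊤-criterion X Y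
  where open IntervalProperties 𝔸
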